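{- For all integers $1\leq k<n$, the metric dimension of the Johnson graph $J(n,k)$ is at most $n$.
   Context: The Johnson graph $J(n,k)$ has as vertices the $k$-subsets of $[n]=\{1,\dots,n\}$, adjacent when their intersection has size $k-1$. The metric dimension of a connected graph is the minimum size of a set $S$ of vertices such that for every pair of distinct vertices $u,v$ some $x\in S$ has $d(u,x)\neq d(v,x)$. -}

module Defs where

open import Data.Nat using (ℕ; zero; suc; _∸_; _<_; _≤_)
open import Data.Fin.Subset using (Subset; ∣_∣; _∩_)
open import Data.List using (List; length)
open import Data.List.Membership.Propositional using (_∈_)
open import Data.List.Relation.Unary.All using (All)
open import Data.Product using (_×_; ∃-syntax)
open import Relation.Binary.PropositionalEquality using (_≡_)
open import Relation.Nullary using (¬_)

IsVertex : (n k : ℕ) → Subset n → Set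
IsVertex n k s = ∣ s ∣ ≡ k

Adj : (n k : ℕ) → Subset n → Subset n → Set
Adj n k u v = IsVertex n k u × IsVertex n k v × ∣ u ∩ v ∣ ≡ k ∸ 1

data Walk (n k : ℕ) : Subset n → Subset n → ℕ → Set where
  here : ∀ {u} → IsVertex n k u → Walk n k u u zero
  step : ∀ {u v w ℓ} → Adj n k u v → Walk n k v w ℓ → Walk n k u w (suc ℓ)

Dist : (n k : ℕ) → Subset n → Subset n → ℕ → Set
Dist n k u v d = Walk n k u v d × (∀ ℓ → ℓ < d → ¬ Walk n k u v ℓ)

Resolving : (n k : ℕ) → List (Subset n) → Set
Resolving n k S =
  All (IsVertex n k) S ×
  (∀ u v → IsVertex n k u → IsVertex n k v → ¬ u ≡ v →
    ∃[ x ] (x ∈ S × ∃[ d₁ ] ∃[ d₂ ] (Dist n k u x d₁ × Dist n k v x d₂ × ¬ d₁ ≡ d₂)))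

MetricDimLe : (n k m : ℕ) → Set
MetricDimLe n k m = ∃[ S ] (Resolving n k S × length S ≤ m)

module Submission where

-- The distance between two k-sets u, x in J(n,k) is k ∸ ∣ u ∩ x ∣: one step
-- along an edge raises the overlap with x by at most one (lower bound), and
-- while u ≠ x one can exchange an element of u ─ x for one of x ─ u, raising
-- the overlap by exactly one (upper bound).  Distances to x are therefore an
-- injective function of ∣ u ∩ x ∣, so a list S of k-sets resolves J(n,k)
-- as soon as it is *separating*: the sizes ∣ u ∩ x ∣ (x ∈ S) determine an
-- arbitrary subset u of [n].  For 1 ≤ k < n a separating list of n k-sets is
-- built by induction on n: for n = k + 1 take the complements of the
-- singletons; from n to n + 1 mark every set as avoiding the new point 0 and
-- add one k-set containing 0.

open import Defs
open import Data.Nat using (ℕ; zero; suc; _+_; _∸_; _≤_; _<_; z≤n; s≤s)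
open import Data.Nat.Properties
open import Data.Bool using (Bool; true; false)
open import Data.Fin using (Fin; zero; suc)
open import Data.Vec using ([]; _∷_; lookup; tabulate)
open import Data.Vec.Properties using (tabulate∘lookup; tabulate-cong; lookup-replicate)
open import Data.Fin.Subset using (Subset; ∣_∣; _∩_; _─_; ∁; ⁅_⁆; ⊥; ⊤)
open import Data.Fin.Subset.Properties using (∩-comm; ∩-idem; ∩-identityʳ; ∣p∩q∣≤∣p∣; ∣∁p∣≡n∸∣p∣; ∣⁅x⁆∣≡1; ∣⊥∣≡0; ∣⊤∣≡n)
open import Data.List as List using (List; _∷_; length; map)
open import Data.List.Properties using (length-map; length-tabulate)
open import Data.List.Membership.Propositional using (_∈_; find)
open import Data.List.Relation.Unary.All as All using (All; _∷_; all?)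
open import Data.List.Relation.Unary.All.Properties using (map⁺; map⁻; tabulate⁺; tabulate⁻; ¬All⇒Any¬)
open import Data.Product using (_×_; _,_; ∃-syntax; proj₁; proj₂)
open import Data.Empty using (⊥-elim)
open import Relation.Binary using (tri<; tri≈; tri>)
open import Relation.Binary.PropositionalEquality
open import Relation.Nullary using (¬_; yes; no)

⟦_⟧ : Bool → ℕ
⟦ false ⟧ = 0
⟦ true  ⟧ = 1

⟦⟧-injective : ∀ a b → ⟦ a ⟧ ≡ ⟦ b ⟧ → a ≡ b
⟦⟧-injective false false _ = refl
⟦⟧-injective true  true  _ = refl

⟦⟧-< : ∀ a b → ⟦ a ⟧ < ⟦ b ⟧ → a ≡ false × b ≡ true
⟦⟧-< false true _ = refl , refl
⟦⟧-< true  true (s≤s ())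

pointwise : ∀ {n} (u v : Subset n) → (∀ i → lookup u i ≡ lookup v i) → u ≡ v
pointwise u v agree = begin
  u                   ≡⟨ tabulate∘lookup u ⟨
  tabulate (lookup u) ≡⟨ tabulate-cong agree ⟩
  tabulate (lookup v) ≡⟨ tabulate∘lookup v ⟩
  v                   ∎
  where open ≡-Reasoning

split : ∀ {n} (p q : Subset n) → ∣ p ∣ ≡ ∣ p ∩ q ∣ + ∣ p ─ q ∣
split []          []          = refl
split (true  ∷ p) (true  ∷ q) = cong suc (split p q)
split (true  ∷ p) (false ∷ q) = trans (cong suc (split p q)) (sym (+-suc _ _))
split (false ∷ p) (true  ∷ q) = split p q
split (false ∷ p) (false ∷ q) = split p q

outside-size : ∀ {n k} (u x : Subset n) → ∣ u ∣ ≡ k → ∣ u ─ x ∣ ≡ k ∸ ∣ u ∩ x ∣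
outside-size u x refl = begin
  ∣ u ─ x ∣                          ≡⟨ m+n∸m≡n ∣ u ∩ x ∣ _ ⟨
  ∣ u ∩ x ∣ + ∣ u ─ x ∣ ∸ ∣ u ∩ x ∣  ≡⟨ cong (_∸ ∣ u ∩ x ∣) (split u x) ⟨
  ∣ u ∣ ∸ ∣ u ∩ x ∣                  ∎
  where open ≡-Reasoning

differences-empty : ∀ {n} (u x : Subset n) → ∣ u ─ x ∣ ≡ 0 → ∣ x ─ u ∣ ≡ 0 → u ≡ x
differences-empty []          []          _ _ = refl
differences-empty (true  ∷ u) (true  ∷ x) p q = cong (true ∷_) (differences-empty u x p q)
differences-empty (false ∷ u) (false ∷ x) p q = cong (false ∷_) (differences-empty u x p q)
differences-empty (true  ∷ u) (false ∷ x) () _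
differences-empty (false ∷ u) (true  ∷ x) _ ()

overlap-growth : ∀ {n} (u v x : Subset n) → ∣ v ∩ x ∣ ≤ ∣ v ─ u ∣ + ∣ u ∩ x ∣
overlap-growth []          []          []          = z≤n
overlap-growth (true  ∷ u) (true  ∷ v) (true  ∷ x) =
  subst (suc ∣ v ∩ x ∣ ≤_) (sym (+-suc _ _)) (s≤s (overlap-growth u v x))
overlap-growth (true  ∷ u) (false ∷ v) (true  ∷ x) =
  subst (∣ v ∩ x ∣ ≤_) (sym (+-suc _ _)) (m≤n⇒m≤1+n (overlap-growth u v x))
overlap-growth (false ∷ u) (true  ∷ v) (true  ∷ x) = s≤s (overlap-growth u v x)
overlap-growth (false ∷ u) (true  ∷ v) (false ∷ x) = m≤n⇒m≤1+n (overlap-growth u v x)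
overlap-growth (true  ∷ u) (true  ∷ v) (false ∷ x) = overlap-growth u v x
overlap-growth (true  ∷ u) (false ∷ v) (false ∷ x) = overlap-growth u v x
overlap-growth (false ∷ u) (false ∷ v) (true  ∷ x) = overlap-growth u v x
overlap-growth (false ∷ u) (false ∷ v) (false ∷ x) = overlap-growth u v x

adjacent-difference : ∀ {n k} {u v : Subset n} → Adj n k u v → ∣ v ─ u ∣ ≤ 1
adjacent-difference {k = k} {u} {v} (_ , ∣v∣≡k , ∣u∩v∣≡k∸1) =
  +-cancelˡ-≤ (k ∸ 1) _ _ (begin
    k ∸ 1 + ∣ v ─ u ∣      ≡⟨ cong (_+ ∣ v ─ u ∣) (trans (sym ∣u∩v∣≡k∸1) (cong ∣_∣ (∩-comm u v))) ⟩
    ∣ v ∩ u ∣ + ∣ v ─ u ∣  ≡⟨ split v u ⟨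
    ∣ v ∣                  ≡⟨ ∣v∣≡k ⟩
    k                      ≤⟨ m≤n+m∸n k 1 ⟩
    1 + (k ∸ 1)            ≡⟨ +-comm 1 (k ∸ 1) ⟩
    k ∸ 1 + 1              ∎)
  where open ≤-Reasoning

-- Lower bound: a walk of length ℓ from u to x forces k ≤ ℓ + ∣ u ∩ x ∣,
-- since every step raises the overlap with x by at most one.
walk-lower-bound : ∀ {n k ℓ} {u x : Subset n} → Walk n k u x ℓ → k ≤ ℓ + ∣ u ∩ x ∣
walk-lower-bound {u = u} (here ∣u∣≡k) =
  ≤-reflexive (trans (sym ∣u∣≡k) (cong ∣_∣ (sym (∩-idem u))))
walk-lower-bound {k = k} {ℓ = suc ℓ} {u} {x} (step {v = v} u~v walk) = begin
  k                          ≤⟨ walk-lower-bound walk ⟩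
  ℓ + ∣ v ∩ x ∣              ≤⟨ +-monoʳ-≤ ℓ (≤-trans (overlap-growth u v x)
                                   (+-monoˡ-≤ ∣ u ∩ x ∣ (adjacent-difference {u = u} {v} u~v))) ⟩
  ℓ + suc ∣ u ∩ x ∣          ≡⟨ +-suc ℓ _ ⟩
  suc ℓ + ∣ u ∩ x ∣          ∎
  where open ≤-Reasoning

-- The result of deleting from u one element of u ─ x (when a holds) and
-- inserting one element of x ─ u (when b holds): size, overlap with u and
-- overlap with x change accordingly.
Exchange : ∀ {n} → Bool → Bool → Subset n → Subset n → Set
Exchange a b u x =
  ∃[ v ] (⟦ a ⟧ + ∣ v ∣ ≡ ⟦ b ⟧ + ∣ u ∣ × ⟦ a ⟧ + ∣ u ∩ v ∣ ≡ ∣ u ∣ × ∣ v ∩ x ∣ ≡ ⟦ b ⟧ + ∣ u ∩ x ∣)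

-- Such an exchange exists whenever the required elements are available.  The
-- recursion runs along the points, performing each pending operation at the
-- first point where it is possible.
exchange : ∀ {n} a b (u x : Subset n) → ⟦ a ⟧ ≤ ∣ u ─ x ∣ → ⟦ b ⟧ ≤ ∣ x ─ u ∣ → Exchange a b u x
exchange false false []          []          _ _ = [] , refl , refl , refl
exchange false true  []          []          _ ()
exchange true  _     []          []          () _
exchange true  _     (true  ∷ u) (false ∷ x) _ q with exchange false _ u x z≤n q
exchange true  false (true  ∷ u) (false ∷ x) _ q | v , e₁ , e₂ , e₃ = false ∷ v , cong suc e₁ , cong suc e₂ , e₃
exchange true  true  (true  ∷ u) (false ∷ x) _ q | v , e₁ , e₂ , e₃ = false ∷ v , cong suc e₁ , cong suc e₂ , e₃
exchange false b     (true  ∷ u) (false ∷ x) _ q with exchange false b u x z≤n q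
... | v , e₁ , e₂ , e₃ = true ∷ v , trans (cong suc e₁) (sym (+-suc ⟦ b ⟧ _)) , cong suc e₂ , e₃
exchange a     true  (false ∷ u) (true  ∷ x) p _ with exchange a false u x p z≤n
exchange false true  (false ∷ u) (true  ∷ x) p _ | v , e₁ , e₂ , e₃ = true ∷ v , cong suc e₁ , e₂ , cong suc e₃
exchange true  true  (false ∷ u) (true  ∷ x) p _ | v , e₁ , e₂ , e₃ = true ∷ v , cong suc e₁ , e₂ , cong suc e₃
exchange a     false (false ∷ u) (true  ∷ x) p _ with exchange a false u x p z≤n
... | v , e₁ , e₂ , e₃ = false ∷ v , e₁ , e₂ , e₃
exchange a     b     (true  ∷ u) (true  ∷ x) p q with exchange a b u x p q
... | v , e₁ , e₂ , e₃ =
  true ∷ v , trans (+-suc ⟦ a ⟧ _) (trans (cong suc e₁) (sym (+-suc ⟦ b ⟧ _))) ,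
  trans (+-suc ⟦ a ⟧ _) (cong suc e₂) , trans (cong suc e₃) (sym (+-suc ⟦ b ⟧ _))
exchange a     b     (false ∷ u) (false ∷ x) p q with exchange a b u x p q
... | v , e₁ , e₂ , e₃ = false ∷ v , e₁ , e₂ , e₃

overlap-bound : ∀ {n k} (u x : Subset n) → IsVertex n k u → ∣ u ∩ x ∣ ≤ k
overlap-bound u x ∣u∣≡k = subst (∣ u ∩ x ∣ ≤_) ∣u∣≡k (∣p∩q∣≤∣p∣ u x)

differences-size : ∀ {n k m} (u x : Subset n) → IsVertex n k u → IsVertex n k x →
                   m + ∣ u ∩ x ∣ ≡ k → ∣ u ─ x ∣ ≡ m × ∣ x ─ u ∣ ≡ m
differences-size {k = k} {m} u x ∣u∣≡k ∣x∣≡k m+c≡k =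
  trans (outside-size u x ∣u∣≡k) k∸c≡m ,
  trans (outside-size x u ∣x∣≡k) (trans (cong (λ c → k ∸ ∣ c ∣) (∩-comm x u)) k∸c≡m)
  where
  k∸c≡m : k ∸ ∣ u ∩ x ∣ ≡ m
  k∸c≡m = trans (cong (_∸ ∣ u ∩ x ∣) (sym m+c≡k)) (m+n∸n≡m m ∣ u ∩ x ∣)

-- Upper bound: k-sets with m + ∣ u ∩ x ∣ ≡ k are joined by a walk of
-- length m, each step exchanging an element of u ─ x for one of x ─ u.
walk-upper-bound : ∀ {n k} m (u x : Subset n) → IsVertex n k u → IsVertex n k x →
                   m + ∣ u ∩ x ∣ ≡ k → Walk n k u x m
walk-upper-bound {n} {k} zero u x ∣u∣≡k ∣x∣≡k c≡k
  with differences-size u x ∣u∣≡k ∣x∣≡k c≡k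
... | u─x≡0 , x─u≡0 = subst (λ y → Walk n k u y 0) (differences-empty u x u─x≡0 x─u≡0) (here ∣u∣≡k)
walk-upper-bound {n} {k} (suc m) u x ∣u∣≡k ∣x∣≡k 1+m+c≡k
  with differences-size u x ∣u∣≡k ∣x∣≡k 1+m+c≡k
... | u─x≡1+m , x─u≡1+m
  with exchange true true u x (subst (1 ≤_) (sym u─x≡1+m) (s≤s z≤n)) (subst (1 ≤_) (sym x─u≡1+m) (s≤s z≤n))
... | v , 1+∣v∣≡1+∣u∣ , 1+∣u∩v∣≡∣u∣ , ∣v∩x∣≡1+∣u∩x∣ =
  step (∣u∣≡k , ∣v∣≡k , cong (_∸ 1) (trans 1+∣u∩v∣≡∣u∣ ∣u∣≡k))
       (walk-upper-bound m v x ∣v∣≡k ∣x∣≡k (trans (cong (m +_) ∣v∩x∣≡1+∣u∩x∣) (trans (+-suc m _) 1+m+c≡k)))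
  where
  ∣v∣≡k : IsVertex n k v
  ∣v∣≡k = trans (suc-injective 1+∣v∣≡1+∣u∣) ∣u∣≡k

distance : ∀ {n k} {u x : Subset n} → IsVertex n k u → IsVertex n k x → Dist n k u x (k ∸ ∣ u ∩ x ∣)
distance {n} {k} {u} {x} ∣u∣≡k ∣x∣≡k =
  walk-upper-bound _ u x ∣u∣≡k ∣x∣≡k (m∸n+n≡m (overlap-bound u x ∣u∣≡k)) , no-shorter
  where
  no-shorter : ∀ ℓ → ℓ < k ∸ ∣ u ∩ x ∣ → ¬ Walk n k u x ℓ
  no-shorter ℓ ℓ<d walk =
    <⇒≱ ℓ<d (m≤n+o⇒m∸n≤o k ∣ u ∩ x ∣ (subst (k ≤_) (+-comm ℓ _) (walk-lower-bound walk)))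

Separating : ∀ {n} → List (Subset n) → Set
Separating {n} S = ∀ (u v : Subset n) → All (λ x → ∣ u ∩ x ∣ ≡ ∣ v ∩ x ∣) S → u ≡ v

-- A separating list of vertices resolves J(n,k): distinct vertices u, v meet
-- some x ∈ S in different numbers of points, hence lie at different
-- distances k ∸ ∣ u ∩ x ∣ ≠ k ∸ ∣ v ∩ x ∣ from x.
separating⇒resolving : ∀ {n k} {S : List (Subset n)} → All (IsVertex n k) S → Separating S → Resolving n k S
separating⇒resolving {n} {k} {S} S-vertices separates = S-vertices , resolve
  where
  resolve : ∀ u v → IsVertex n k u → IsVertex n k v → ¬ u ≡ v →
            ∃[ x ] (x ∈ S × ∃[ d₁ ] ∃[ d₂ ] (Dist n k u x d₁ × Dist n k v x d₂ × ¬ d₁ ≡ d₂))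
  resolve u v ∣u∣≡k ∣v∣≡k u≢v with all? (λ x → ∣ u ∩ x ∣ ≟ ∣ v ∩ x ∣) S
  ... | yes agree = ⊥-elim (u≢v (separates u v agree))
  ... | no disagree with find (¬All⇒Any¬ (λ x → ∣ u ∩ x ∣ ≟ ∣ v ∩ x ∣) S disagree)
  ... | x , x∈S , overlaps-differ =
    x , x∈S , _ , _ , distance ∣u∣≡k ∣x∣≡k , distance ∣v∣≡k ∣x∣≡k ,
    λ d≡d → overlaps-differ (∸-cancelˡ-≡ (overlap-bound u x ∣u∣≡k) (overlap-bound v x ∣v∣≡k) d≡d)
    where
    ∣x∣≡k : IsVertex n k x
    ∣x∣≡k = All.lookup S-vertices x∈S

∁⊥≡⊤ : ∀ n → ∁ (⊥ {n}) ≡ ⊤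
∁⊥≡⊤ zero    = refl
∁⊥≡⊤ (suc n) = cong (true ∷_) (∁⊥≡⊤ n)

∩-∁⊥ : ∀ {n} (u : Subset n) → ∣ u ∩ ∁ ⊥ ∣ ≡ ∣ u ∣
∩-∁⊥ {n} u = cong ∣_∣ (trans (cong (u ∩_) (∁⊥≡⊤ n)) (∩-identityʳ u))

removal-count : ∀ {m} (u : Subset m) (i : Fin m) → ⟦ lookup u i ⟧ + ∣ u ∩ ∁ ⁅ i ⁆ ∣ ≡ ∣ u ∣
removal-count (true  ∷ u) zero    = cong suc (∩-∁⊥ u)
removal-count (false ∷ u) zero    = ∩-∁⊥ u
removal-count (true  ∷ u) (suc i) = trans (+-suc ⟦ lookup u i ⟧ _) (cong suc (removal-count u i))
removal-count (false ∷ u) (suc i) = removal-count u i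

co-singleton-size : ∀ {k} (i : Fin (suc k)) → ∣ ∁ ⁅ i ⁆ ∣ ≡ k
co-singleton-size {k} i = trans (∣∁p∣≡n∸∣p∣ ⁅ i ⁆) (cong (suc k ∸_) (∣⁅x⁆∣≡1 i))

-- Agreement on all complements of singletons cannot occur with ∣ u ∣ < ∣ v ∣
-- in a set of at least two points: by removal-count every point would lie in
-- v but not in u, so u = ⊥ and v = ⊤, and the point 0 then gives 0 = 1 + m.
co-singletons-smaller : ∀ {m} (u v : Subset (suc (suc m))) → ∣ u ∣ < ∣ v ∣ →
                        ¬ (∀ i → ∣ u ∩ ∁ ⁅ i ⁆ ∣ ≡ ∣ v ∩ ∁ ⁅ i ⁆ ∣)
co-singletons-smaller {m} u v ∣u∣<∣v∣ agree = 0≢1+n (trans (sym c₀≡0) (suc-injective 1+c₀≡2+m))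
  where
  count-u : ∀ i → ⟦ lookup u i ⟧ + ∣ v ∩ ∁ ⁅ i ⁆ ∣ ≡ ∣ u ∣
  count-u i = trans (cong (⟦ lookup u i ⟧ +_) (sym (agree i))) (removal-count u i)

  bits : ∀ i → lookup u i ≡ false × lookup v i ≡ true
  bits i = ⟦⟧-< _ _ (+-cancelʳ-< ∣ v ∩ ∁ ⁅ i ⁆ ∣ _ _
             (subst₂ _<_ (sym (count-u i)) (sym (removal-count v i)) ∣u∣<∣v∣))

  u≡⊥ : u ≡ ⊥
  u≡⊥ = pointwise u ⊥ (λ i → trans (proj₁ (bits i)) (sym (lookup-replicate i false)))

  v≡⊤ : v ≡ ⊤
  v≡⊤ = pointwise v ⊤ (λ i → trans (proj₂ (bits i)) (sym (lookup-replicate i true)))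

  c₀ : ℕ
  c₀ = ∣ v ∩ ∁ ⁅ zero ⁆ ∣

  c₀≡0 : c₀ ≡ 0
  c₀≡0 = begin
    c₀                      ≡⟨ cong (λ b → ⟦ b ⟧ + c₀) (proj₁ (bits zero)) ⟨
    ⟦ lookup u zero ⟧ + c₀  ≡⟨ count-u zero ⟩
    ∣ u ∣                   ≡⟨ cong ∣_∣ u≡⊥ ⟩
    ∣ ⊥ {suc (suc m)} ∣     ≡⟨ ∣⊥∣≡0 (suc (suc m)) ⟩
    0                       ∎
    where open ≡-Reasoning

  1+c₀≡2+m : suc c₀ ≡ suc (suc m)
  1+c₀≡2+m = begin
    suc c₀                  ≡⟨ cong (λ b → ⟦ b ⟧ + c₀) (proj₂ (bits zero)) ⟨
    ⟦ lookup v zero ⟧ + c₀  ≡⟨ removal-count v zero ⟩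
    ∣ v ∣                   ≡⟨ cong ∣_∣ v≡⊤ ⟩
    ∣ ⊤ {suc (suc m)} ∣     ≡⟨ ∣⊤∣≡n (suc (suc m)) ⟩
    suc (suc m)             ∎
    where open ≡-Reasoning

-- In a set of at least two points, agreement on all complements of
-- singletons forces equality: by co-singletons-smaller the sizes agree, and
-- then removal-count recovers every membership bit.
co-singletons-determine : ∀ {m} (u v : Subset (suc (suc m))) →
                          (∀ i → ∣ u ∩ ∁ ⁅ i ⁆ ∣ ≡ ∣ v ∩ ∁ ⁅ i ⁆ ∣) → u ≡ v
co-singletons-determine u v agree with <-cmp ∣ u ∣ ∣ v ∣
... | tri< ∣u∣<∣v∣ _ _ = ⊥-elim (co-singletons-smaller u v ∣u∣<∣v∣ agree)
... | tri> _ _ ∣v∣<∣u∣ = ⊥-elim (co-singletons-smaller v u ∣v∣<∣u∣ (λ i → sym (agree i)))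
... | tri≈ _ ∣u∣≡∣v∣ _ = pointwise u v λ i → ⟦⟧-injective _ _ (+-cancelʳ-≡ ∣ v ∩ ∁ ⁅ i ⁆ ∣ _ _ (begin
    ⟦ lookup u i ⟧ + ∣ v ∩ ∁ ⁅ i ⁆ ∣  ≡⟨ cong (⟦ lookup u i ⟧ +_) (agree i) ⟨
    ⟦ lookup u i ⟧ + ∣ u ∩ ∁ ⁅ i ⁆ ∣  ≡⟨ removal-count u i ⟩
    ∣ u ∣                             ≡⟨ ∣u∣≡∣v∣ ⟩
    ∣ v ∣                             ≡⟨ removal-count v i ⟨
    ⟦ lookup v i ⟧ + ∣ v ∩ ∁ ⁅ i ⁆ ∣  ∎))
  where open ≡-Reasoning

co-singletons : ∀ m → List (Subset m)
co-singletons m = List.tabulate (λ i → ∁ ⁅ i ⁆)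

co-singletons-separate : ∀ m → Separating (co-singletons (suc (suc m)))
co-singletons-separate m u v agree =
  co-singletons-determine u v (tabulate⁻ {f = λ i → ∁ ⁅ i ⁆} agree)

tail-overlap : ∀ {n} a (u x : Subset n) → ∣ (a ∷ u) ∩ (false ∷ x) ∣ ≡ ∣ u ∩ x ∣
tail-overlap true  u x = refl
tail-overlap false u x = refl

-- The old sets determine u and v away from 0, and the new set then
-- detects whether 0 belongs to them.
extend-separating : ∀ {n} (e : Subset n) (S : List (Subset n)) →
                    Separating S → Separating ((true ∷ e) ∷ map (false ∷_) S)
extend-separating e S separates (a ∷ u) (b ∷ v) (agree-new ∷ agree-old)
  with separates u v (All.map (λ {x} p → trans (sym (tail-overlap a u x)) (trans p (tail-overlap b v x)))
                              (map⁻ agree-old))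
... | refl with a | b
...   | true  | true  = refl
...   | false | false = refl
...   | true  | false = ⊥-elim (1+n≢n agree-new)
...   | false | true  = ⊥-elim (1+n≢n (sym agree-new))

initial : (n m : ℕ) → Subset n
initial n       zero    = ⊥
initial zero    (suc m) = []
initial (suc n) (suc m) = true ∷ initial n m

initial-size : ∀ {n m} → m ≤ n → ∣ initial n m ∣ ≡ m
initial-size {n} z≤n   = ∣⊥∣≡0 n
initial-size (s≤s m≤n) = cong suc (initial-size m≤n)

SeparatingFamily : ℕ → ℕ → Set
SeparatingFamily n k = ∃[ S ] (All (IsVertex n k) S × length S ≡ n × Separating S)

-- Separating families exist for k ≥ 1 and n = j + k + 1, by induction on j:
-- the complements of singletons to start with, then extend-separating with
-- the new (k + 1)-set {0, 1, …, k}.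
separating-family : ∀ j k → SeparatingFamily (j + suc (suc k)) (suc k)
separating-family zero k =
  co-singletons (suc (suc k)) , tabulate⁺ {f = λ i → ∁ ⁅ i ⁆} co-singleton-size ,
  length-tabulate (λ i → ∁ ⁅ i ⁆) , co-singletons-separate k
separating-family (suc j) k with separating-family j k
... | S , S-vertices , length-S , separates =
  (true ∷ initial N k) ∷ map (false ∷_) S ,
  cong suc (initial-size k≤N) ∷ map⁺ S-vertices ,
  cong suc (trans (length-map (false ∷_) S) length-S) ,
  extend-separating (initial N k) S separates
  where
  N : ℕ
  N = j + suc (suc k)
  k≤N : k ≤ N
  k≤N = ≤-trans (≤-trans (n≤1+n k) (n≤1+n (suc k))) (m≤n+m (suc (suc k)) j)

family⇒metric-dimension : ∀ {n k} → SeparatingFamily n k → MetricDimLe n k n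
family⇒metric-dimension (S , S-vertices , length-S , separates) =
  S , separating⇒resolving S-vertices separates , ≤-reflexive length-S

corollary3p3 : (n k : ℕ) → 1 ≤ k → k < n → MetricDimLe n k n
corollary3p3 n (suc k) _ k<n with m≤n⇒∃[o]m+o≡n k<n
... | j , 2+k+j≡n =
  subst (λ N → MetricDimLe N (suc k) N) (trans (+-comm j (suc (suc k))) 2+k+j≡n)
        (family⇒metric-dimension (separating-family j k))
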